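{- Let $t$ be a positive integer, let $\mathcal A\in I(n,t)$ be maximal, fixed and compressed, and let $g\in G_*(\mathcal A)$. For $E\in g$ define $\mathscr D(E)=\{\sigma\in S_n:\mathrm{fix}(\sigma)\cap[s^+(E)]=E\}$. Then $\mathcal A$ is the disjoint union $\mathcal A=\dot{\bigcup}_{E\in g}\mathscr D(E)$.
   Context: $S_n$ is the symmetric group on $[n]=\{1,\dots,n\}$; $\mathrm{fix}(\sigma)=\{x:\sigma(x)=x\}$; $[m]=\{1,\dots,m\}$. Two permutations have a cycle in common if that cycle appears in both cycle decompositions (1-cycles count). $\mathcal A\subseteq S_n$ is $t$-cycle-intersecting if any two distinct members have at least $t$ common cycles; $I(n,t)$ is the collection of all such families; $\mathcal A\in I(n,t)$ is maximal if no $\sigma\notin\mathcal A$ can be added keeping the property. Fixing: for $i\ne j$, ${}_{[ij]}\sigma=\sigma$ if $\sigma(i)\ne j$; if $\sigma(i)=j$, ${}_{[ij]}\sigma(i)=i$, ${}_{[ij]}\sigma(\sigma^{ -1}(i))=j$, ${}_{[ij]}\sigma(x)=\sigma(x)$ otherwise; $\triangleleft_{ij}(\mathcal A)=\{\triangleleft_{ij}(\sigma):\sigma\in\mathcal A\}$ with $\triangleleft_{ij}(\sigma)={}_{[ij]}\sigma$ if ${}_{[ij]}\sigma\notin\mathcal A$, else $\sigma$; $\mathcal A$ is fixed if $\triangleleft_{ij}(\mathcal A)=\mathcal A$ for all $i\ne j$. Compression: for $i<j$, $\sigma_{i,j}=\sigma$ if $\sigma(i)=i$ or $\sigma(j)\ne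 j$; otherwise $\sigma_{i,j}(i)=i$, $\sigma_{i,j}(j)=\sigma(i)$, $\sigma_{i,j}(\sigma^{ -1}(i))=j$, $\sigma_{i,j}(y)=\sigma(y)$ otherwise; $\mathcal C_{i,j}(\mathcal A)=\{\mathcal C_{i,j}(\sigma):\sigma\in\mathcal A\}$ with $\mathcal C_{i,j}(\sigma)=\sigma_{i,j}$ if $\sigma_{i,j}\notin\mathcal A$, else $\sigma$; $\mathcal A$ is compressed if $\mathcal C_{i,j}(\mathcal A)=\mathcal A$ for all $i<j$. $\mathscr U_p(B)=\{\sigma: B\subseteq\mathrm{fix}(\sigma)\}$, $\mathscr U_p(\mathcal B)=\bigcup_{B\in\mathcal B}\mathscr U_p(B)$; a generating set for $\mathcal A$ is a collection $g$ of subsets of $[n]$ with no set of size $n-1$ and $\mathscr U_p(g)=\mathcal A$; $G(\mathcal A)$ is the set of generating sets. For $B=\{b_1<\dots<b_k\}$, $\mathscr L(B)=\{\{a_1<\dots<a_k\}\subseteq[n]: a_i\le b_i\ \forall i\}$; $\mathscr L(g)=\bigcup_{B\in g}\mathscr L(B)$; $\mathscr L_*(g)$ is the set of inclusion-minimal elements of $\mathscr L(g)$. $G_*(\mathcal A)=\{g\in G(\mathcal A):\mathscr L_*(g)=g\}$. $s^+(E)$ is the largest element of $E$. -}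

module Defs where

open import Data.Nat as ℕ using (ℕ; zero; suc; _∸_; _⊔_; _<_)
open import Data.Fin as F using (Fin; toℕ; _≟_)
open import Data.Fin.Subset using (Subset; _∈_; _⊆_; ∣_∣)
open import Data.Bool using (Bool; true; false; if_then_else_)
open import Data.Vec using (Vec; []; _∷_; lookup; tabulate)
open import Data.List using (List; []; _∷_; map; foldr)
open import Data.List.Relation.Binary.Pointwise using (Pointwise)
open import Data.Product using (Σ; ∃; ∃-syntax; _×_)
open import Data.Sum using (_⊎_)
open import Relation.Nullary using (¬_; does)
open import Relation.Binary.PropositionalEquality using (_≡_; _≢_)
open import Function.Bundles using (_⇔_)

-- Points of [n] are Fin n (element x stands for 1 + toℕ x).
-- A "word" is a map [n] → [n] given as its table; σ(x) = lookup σ x.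
Word : ℕ → Set
Word n = Vec (Fin n) n

app : ∀ {n} → Word n → Fin n → Fin n
app = lookup

-- σ ∈ S_n : the map is injective (hence bijective on the finite set)
IsPerm : ∀ {n} → Word n → Set
IsPerm σ = ∀ x y → app σ x ≡ app σ y → x ≡ y

iter : ∀ {n} → Word n → ℕ → Fin n → Fin n
iter σ zero    x = x
iter σ (suc k) x = app σ (iter σ k x)

-- σ and τ have at least t cycles in common: there are t points x_1..x_t
-- lying in pairwise distinct σ-cycles such that the σ-cycle through each
-- x_k coincides with the τ-cycle through x_k (σ^m x_k = τ^m x_k for all m).
CommonCycles≥ : ∀ {n} → ℕ → Word n → Word n → Set
CommonCycles≥ {n} t σ τ =
  Σ (Fin t → Fin n) λ xs →
    (∀ k m → iter σ m (xs k) ≡ iter τ m (xs k)) ×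
    (∀ k l → k ≢ l → ∀ m → iter σ m (xs k) ≢ xs l)

Family : ℕ → Set
Family n = Word n → Bool

_∈ᶠ_ : ∀ {n} → Word n → Family n → Set
σ ∈ᶠ A = A σ ≡ true

TInt : ∀ {n} → ℕ → (Word n → Set) → Set
TInt t P = ∀ σ τ → P σ → P τ → σ ≢ τ → CommonCycles≥ t σ τ

InI : (n t : ℕ) → Family n → Set
InI n t A = (∀ σ → σ ∈ᶠ A → IsPerm σ) × TInt t (λ σ → σ ∈ᶠ A)

Maximal : (n t : ℕ) → Family n → Set
Maximal n t A = InI n t A ×
  (∀ σ → IsPerm σ → ¬ (σ ∈ᶠ A) → ¬ TInt t (λ τ → τ ∈ᶠ A ⊎ τ ≡ σ))

_≐_ : ∀ {n} → (Word n → Set) → (Word n → Set) → Set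
P ≐ Q = ∀ σ → P σ ⇔ Q σ

Op : ∀ {n} → Family n → (Word n → Word n) → Word n → Set
Op A f τ = ∃[ σ ] (σ ∈ᶠ A × (if A (f σ) then σ else f σ) ≡ τ)

fixOp : ∀ {n} → Fin n → Fin n → Word n → Word n
fixOp i j σ =
  if does (app σ i ≟ j)
  then tabulate (λ x → if does (x ≟ i) then i
                       else if does (app σ x ≟ i) then j
                       else app σ x)
  else σ

Fixed : ∀ {n} → Family n → Set
Fixed {n} A = ∀ (i j : Fin n) → i ≢ j → Op A (fixOp i j) ≐ (λ σ → σ ∈ᶠ A)

compOp : ∀ {n} → Fin n → Fin n → Word n → Word n
compOp i j σ =
  if does (app σ i ≟ i) then σ
  else if does (app σ j ≟ j)
  then tabulate (λ x → if does (x ≟ i) then i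
                       else if does (x ≟ j) then app σ i
                       else if does (app σ x ≟ i) then j
                       else app σ x)
  else σ

Compressed : ∀ {n} → Family n → Set
Compressed {n} A = ∀ (i j : Fin n) → i F.< j → Op A (compOp i j) ≐ (λ σ → σ ∈ᶠ A)

Coll : ℕ → Set
Coll n = Subset n → Bool

_∈ᶜ_ : ∀ {n} → Subset n → Coll n → Set
B ∈ᶜ g = g B ≡ true

fix⊇ : ∀ {n} → Subset n → Word n → Set
fix⊇ B σ = ∀ x → x ∈ B → app σ x ≡ x

Up : ∀ {n} → Coll n → Word n → Set
Up g σ = IsPerm σ × ∃[ B ] (B ∈ᶜ g × fix⊇ B σ)

IsGenSet : ∀ {n} → Family n → Coll n → Set
IsGenSet {n} A g = (∀ B → B ∈ᶜ g → ∣ B ∣ ≢ n ∸ 1) × (Up g ≐ (λ σ → σ ∈ᶠ A))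

elems : ∀ {n} → Subset n → List (Fin n)
elems {zero}  []      = []
elems {suc n} (b ∷ p) = if b then F.zero ∷ map F.suc (elems p) else map F.suc (elems p)

-- A ∈ 𝓛(B):  |A| = |B| and a_i ≤ b_i for all i
InL : ∀ {n} → Subset n → Subset n → Set
InL B A = Pointwise F._≤_ (elems A) (elems B)

InLg : ∀ {n} → Coll n → Subset n → Set
InLg g A = ∃[ B ] (B ∈ᶜ g × InL B A)

InL* : ∀ {n} → Coll n → Subset n → Set
InL* g A = InLg g A × (∀ A' → InLg g A' → A' ⊆ A → A' ≡ A)

IsGenSet* : ∀ {n} → Family n → Coll n → Set
IsGenSet* A g = IsGenSet A g × (∀ E → InL* g E ⇔ E ∈ᶜ g)

-- s⁺(E) as a number in 1..n (value 0 for E = ∅, so that [s⁺(∅)] = ∅)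
sPlus : ∀ {n} → Subset n → ℕ
sPlus E = foldr (λ x m → suc (toℕ x) ⊔ m) 0 (elems E)

D : ∀ {n} → Subset n → Word n → Set
D E σ = IsPerm σ × (∀ x → (x ∈ E) ⇔ (app σ x ≡ x × toℕ x < sPlus E))

module Submission where

-- Covering.  Let σ ∈ A with fixed-point set F.  Some B ∈ g lies in F, so we
-- may choose a member S of 𝓛(g) inside F of least size, and let P be the
-- ∣ S ∣ smallest elements of F.  Elementwise P lies below S (the shadow
-- lemma), so P ∈ 𝓛(g); a member of 𝓛(g) inside P is inside F, hence has
-- size at least ∣ S ∣ ≥ ∣ P ∣ and equals P.  Thus P is minimal, so P ∈ g, and
-- since P is an initial segment of F we have fix(σ) ∩ [s⁺(P)] = P, i.e.
-- σ ∈ 𝒟(P).  Conversely σ ∈ 𝒟(E) with E ∈ g fixes E, so σ ∈ 𝒰_p(g) = A.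
--
-- Disjointness.  If σ ∈ 𝒟(E) ∩ 𝒟(E') and s⁺(E) ≤ s⁺(E'), then E ⊆ E', and
-- members of g are ⊆-incomparable, so E = E'.

open import Defs
open import Data.Nat using (ℕ; _≤_)
open import Data.Fin.Subset using (Subset)
open import Data.Product using (_×_; ∃-syntax)
open import Relation.Nullary using (¬_)
open import Relation.Binary.PropositionalEquality using (_≢_)

open import Data.Nat using (zero; suc; _+_; _<_; _⊔_; _<?_; z≤n; s≤s)
open import Data.Nat.Properties
  using (≤-trans; <-≤-trans; ≤-total; ≮⇒≥; <⇒≱; ≤-pred; ⊔-sel; m≤m⊔n; m≤n⊔m;
         m≤n+m; ≤-reflexive; +-suc; +-identityʳ; suc-injective)
open import Data.Nat.Induction using (<-wellFounded)
open import Induction.WellFounded using (Acc; acc)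
open import Data.Fin using (Fin; toℕ; _≟_)
import Data.Fin as Fin
open import Data.Fin.Properties
  using ()
  renaming (≤-refl to ≤ᶠ-refl; ≤-trans to ≤ᶠ-trans; _≤?_ to _≤ᶠ?_)
open import Data.Fin.Subset using (_∈_; _⊆_; ∣_∣)
open import Data.Fin.Subset.Properties using (anySubset?; _⊆?_; drop-∷-⊆; p⊆q⇒∣p∣≤∣q∣)
open import Data.Bool using (true; false)
open import Data.Bool.Properties using () renaming (_≟_ to _≟ᵇ_)
open import Data.Vec using ([]; _∷_; here; there; lookup; tabulate)
open import Data.Vec.Properties using (lookup∘tabulate; []=⇒lookup; lookup⇒[]=)
open import Data.List using (List; []; _∷_; map; foldr; length; drop)
open import Data.List.Properties using (length-map; drop-map; drop-all)
open import Data.List.Relation.Binary.Pointwise as Pointwise using (Pointwise; []; _∷_)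
open import Data.List.Relation.Unary.Any using (here; there)
import Data.List.Membership.Propositional as List
open import Data.List.Membership.Propositional.Properties using (∈-map⁺; ∈-map⁻)
open import Data.Product using (_,_; proj₁; proj₂)
open import Data.Sum using (inj₁; inj₂)
open import Data.Empty using (⊥-elim)
open import Relation.Unary using (Decidable)
open import Relation.Nullary using (yes; no; does)
open import Relation.Nullary.Decidable using (_×-dec_; dec-true; proof)
open import Relation.Nullary.Reflects using (Reflects; invert)
open import Relation.Binary.PropositionalEquality using (_≡_; refl; sym; trans; cong; subst; subst₂)
open import Function.Bundles using (_⇔_; mk⇔; Equivalence)

private
  variable
    n : ℕ

least-size : {P : Subset n → Set} → Decidable P → ∀ {S} → P S →
             ∃[ S* ] (P S* × (∀ S' → P S' → ∣ S* ∣ ≤ ∣ S' ∣))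
least-size {P = P} P? {S} PS = descend S PS (<-wellFounded ∣ S ∣)
  where
  descend : ∀ S → P S → Acc _<_ ∣ S ∣ →
            ∃[ S* ] (P S* × (∀ S' → P S' → ∣ S* ∣ ≤ ∣ S' ∣))
  descend S PS (acc smaller) with anySubset? (λ S' → P? S' ×-dec (∣ S' ∣ <? ∣ S ∣))
  ... | yes (S' , PS' , S'<S) = descend S' PS' (smaller S'<S)
  ... | no none = S , PS , λ S' PS' → ≮⇒≥ (λ S'<S → none (S' , PS' , S'<S))

⊆-size-≡ : ∀ {A S : Subset n} → A ⊆ S → ∣ S ∣ ≤ ∣ A ∣ → A ≡ S
⊆-size-≡ {A = []}        {[]}        _   _         = refl
⊆-size-≡ {A = true ∷ A}  {true ∷ S}  A⊆S (s≤s S≤A) = cong (true ∷_) (⊆-size-≡ (drop-∷-⊆ A⊆S) S≤A)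
⊆-size-≡ {A = true ∷ A}  {false ∷ S} A⊆S _         with A⊆S here
... | ()
⊆-size-≡ {A = false ∷ A} {true ∷ S}  A⊆S S<A       = ⊥-elim (<⇒≱ S<A (p⊆q⇒∣p∣≤∣q∣ (drop-∷-⊆ A⊆S)))
⊆-size-≡ {A = false ∷ A} {false ∷ S} A⊆S S≤A       = cong (false ∷_) (⊆-size-≡ (drop-∷-⊆ A⊆S) S≤A)

fixSet : Word n → Subset n
fixSet σ = tabulate (λ x → does (app σ x ≟ x))

∈fixSet⇔ : (σ : Word n) (x : Fin n) → x ∈ fixSet σ ⇔ app σ x ≡ x
∈fixSet⇔ σ x = mk⇔ fixed in-fixSet
  where
  entry : lookup (fixSet σ) x ≡ does (app σ x ≟ x)
  entry = lookup∘tabulate (λ y → does (app σ y ≟ y)) x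

  fixed : x ∈ fixSet σ → app σ x ≡ x
  fixed x∈ = invert (subst (Reflects _) (trans (sym entry) ([]=⇒lookup x∈)) (proof (app σ x ≟ x)))

  in-fixSet : app σ x ≡ x → x ∈ fixSet σ
  in-fixSet σx≡x = lookup⇒[]= x (fixSet σ) (trans entry (dec-true (app σ x ≟ x) σx≡x))

∈⇒∈elems : ∀ {E : Subset n} {x} → x ∈ E → x List.∈ elems E
∈⇒∈elems {E = true ∷ E}  here      = here refl
∈⇒∈elems {E = true ∷ E}  (there p) = there (∈-map⁺ Fin.suc (∈⇒∈elems p))
∈⇒∈elems {E = false ∷ E} (there p) = ∈-map⁺ Fin.suc (∈⇒∈elems p)

∈elems⇒∈ : ∀ {E : Subset n} {x} → x List.∈ elems E → x ∈ E
∈elems⇒∈ {E = true ∷ E}  (here refl) = here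
∈elems⇒∈ {E = true ∷ E}  (there p)   with ∈-map⁻ Fin.suc p
... | _ , q , refl = there (∈elems⇒∈ q)
∈elems⇒∈ {E = false ∷ E} p           with ∈-map⁻ Fin.suc p
... | _ , q , refl = there (∈elems⇒∈ q)

length-elems : (E : Subset n) → length (elems E) ≡ ∣ E ∣
length-elems []          = refl
length-elems (true ∷ E)  = cong suc (trans (length-map Fin.suc (elems E)) (length-elems E))
length-elems (false ∷ E) = trans (length-map Fin.suc (elems E)) (length-elems E)

room : ∀ (E : Subset n) k d → ∣ E ∣ ≡ k + suc d → d < length (elems E)
room E k d ∣E∣≡ = subst (d <_) (sym (trans (length-elems E) ∣E∣≡)) (m≤n+m (suc d) k)

bound : List (Fin n) → ℕ
bound = foldr (λ x m → suc (toℕ x) ⊔ m) 0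

<bound : ∀ {x : Fin n} {l} → x List.∈ l → toℕ x < bound l
<bound {x = x} {_ ∷ l} (here refl) = m≤m⊔n (suc (toℕ x)) (bound l)
<bound {l = y ∷ l}     (there p)   = ≤-trans (<bound p) (m≤n⊔m (suc (toℕ y)) (bound l))

below-bound : ∀ {x : Fin n} (l : List (Fin n)) → toℕ x < bound l →
              ∃[ y ] (y List.∈ l × toℕ x ≤ toℕ y)
below-bound (y ∷ l) x< with ⊔-sel (suc (toℕ y)) (bound l)
... | inj₁ ≡y = y , here refl , ≤-pred (subst (_ <_) ≡y x<)
... | inj₂ ≡l with below-bound l (subst (_ <_) ≡l x<)
...   | z , z∈l , x≤z = z , there z∈l , x≤z

<sPlus : ∀ {E : Subset n} {x} → x ∈ E → toℕ x < sPlus E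
<sPlus x∈E = <bound (∈⇒∈elems x∈E)

below-sPlus : ∀ (E : Subset n) {x} → toℕ x < sPlus E → ∃[ y ] (y ∈ E × toℕ x ≤ toℕ y)
below-sPlus E x< with below-bound (elems E) x<
... | y , y∈ , x≤y = y , ∈elems⇒∈ y∈ , x≤y

initial : ℕ → Subset n → Subset n
initial k       []          = []
initial zero    (_ ∷ F)     = false ∷ initial zero F
initial (suc k) (true ∷ F)  = true ∷ initial k F
initial (suc k) (false ∷ F) = false ∷ initial (suc k) F

initial-⊆ : ∀ k (F : Subset n) → initial k F ⊆ F
initial-⊆ zero    (_ ∷ F)     (there x∈) = there (initial-⊆ zero F x∈)
initial-⊆ (suc k) (true ∷ F)  here       = here
initial-⊆ (suc k) (true ∷ F)  (there x∈) = there (initial-⊆ k F x∈)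
initial-⊆ (suc k) (false ∷ F) (there x∈) = there (initial-⊆ (suc k) F x∈)

∣initial∣≤ : ∀ k (F : Subset n) → ∣ initial k F ∣ ≤ k
∣initial∣≤ k       []          = z≤n
∣initial∣≤ zero    (_ ∷ F)     = ∣initial∣≤ zero F
∣initial∣≤ (suc k) (true ∷ F)  = s≤s (∣initial∣≤ k F)
∣initial∣≤ (suc k) (false ∷ F) = ∣initial∣≤ (suc k) F

initial-zero-∉ : ∀ (F : Subset n) {y} → ¬ (y ∈ initial zero F)
initial-zero-∉ (_ ∷ F) (there y∈) = initial-zero-∉ F y∈

elems-initial-zero : (F : Subset n) → elems (initial zero F) ≡ []
elems-initial-zero []      = refl
elems-initial-zero (_ ∷ F) = cong (map Fin.suc) (elems-initial-zero F)

initial-closed : ∀ k (F : Subset n) {x y} → x ∈ F → y ∈ initial k F → toℕ x ≤ toℕ y →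
                 x ∈ initial k F
initial-closed zero    F           _ y∈ _ = ⊥-elim (initial-zero-∉ F y∈)
initial-closed (suc k) (true ∷ F)  {Fin.zero} _ _ _ = here
initial-closed (suc k) (true ∷ F)  {Fin.suc x} {Fin.suc y} (there x∈) (there y∈) (s≤s x≤y) =
  there (initial-closed k F x∈ y∈ x≤y)
initial-closed (suc k) (false ∷ F) {Fin.suc x} {Fin.suc y} (there x∈) (there y∈) (s≤s x≤y) =
  there (initial-closed (suc k) F x∈ y∈ x≤y)

-- The shadow lemma: initial segments lie elementwise below subsets.

_≤*_ : List (Fin n) → List (Fin n) → Set
_≤*_ = Pointwise Fin._≤_

suc-≤* : ∀ {xs ys : List (Fin n)} → xs ≤* ys → map Fin.suc xs ≤* map Fin.suc ys
suc-≤* xs≤ys = Pointwise.map⁺ Fin.suc Fin.suc (Pointwise.map s≤s xs≤ys)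

shift-≤* : ∀ d (X Y : List (Fin n)) → d < length Y → X ≤* drop (suc d) Y →
           (Fin.zero ∷ map Fin.suc X) ≤* drop d (map Fin.suc Y)
shift-≤* zero    X (y ∷ Y) _        X≤ = z≤n ∷ suc-≤* X≤
shift-≤* (suc d) X (y ∷ Y) (s≤s d<) X≤ = shift-≤* d X Y d< X≤

-- If E ⊆ F and ∣ E ∣ = k + d, the k smallest elements of F lie elementwise
-- below the k largest elements of E.  (Generalising from d = 0 to all d is
-- what makes the induction go through.)
initial-≤*-drop : ∀ k d (E F : Subset n) → E ⊆ F → ∣ E ∣ ≡ k + d →
                  elems (initial k F) ≤* drop d (elems E)
initial-≤*-drop zero d E F _ ∣E∣≡ =
  subst₂ _≤*_ (sym (elems-initial-zero F))
              (sym (drop-all d (elems E) (≤-reflexive (trans (length-elems E) ∣E∣≡))))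
              []
initial-≤*-drop (suc k) d (true ∷ E) (false ∷ F) E⊆F _ with E⊆F here
... | ()
initial-≤*-drop (suc k) zero (true ∷ E) (true ∷ F) E⊆F ∣E∣≡ =
  z≤n ∷ suc-≤* (initial-≤*-drop k 0 E F (drop-∷-⊆ E⊆F) (suc-injective ∣E∣≡))
initial-≤*-drop (suc k) (suc d) (true ∷ E) (true ∷ F) E⊆F ∣E∣≡ =
  shift-≤* d (elems (initial k F)) (elems E) (room E k d (suc-injective ∣E∣≡))
    (initial-≤*-drop k (suc d) E F (drop-∷-⊆ E⊆F) (suc-injective ∣E∣≡))
initial-≤*-drop (suc k) d (false ∷ E) (true ∷ F) E⊆F ∣E∣≡ =
  shift-≤* d (elems (initial k F)) (elems E) (room E k d ∣E∣≡′)
    (initial-≤*-drop k (suc d) E F (drop-∷-⊆ E⊆F) ∣E∣≡′)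
  where
  ∣E∣≡′ : ∣ E ∣ ≡ k + suc d
  ∣E∣≡′ = trans ∣E∣≡ (sym (+-suc k d))
initial-≤*-drop (suc k) d (false ∷ E) (false ∷ F) E⊆F ∣E∣≡ =
  subst (map Fin.suc (elems (initial (suc k) F)) ≤*_) (sym (drop-map d (elems E)))
    (suc-≤* (initial-≤*-drop (suc k) d E F (drop-∷-⊆ E⊆F) ∣E∣≡))

initial-∈𝓛 : ∀ {E F : Subset n} → E ⊆ F → InL E (initial ∣ E ∣ F)
initial-∈𝓛 {E = E} {F} E⊆F = initial-≤*-drop ∣ E ∣ 0 E F E⊆F (sym (+-identityʳ ∣ E ∣))

𝒟-⊆ : ∀ {E E' : Subset n} σ → D E σ → D E' σ → sPlus E ≤ sPlus E' → E ⊆ E'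
𝒟-⊆ σ (_ , σ∈𝒟E) (_ , σ∈𝒟E') s⁺E≤s⁺E' x∈E with Equivalence.to (σ∈𝒟E _) x∈E
... | σx≡x , x<s⁺E = Equivalence.from (σ∈𝒟E' _) (σx≡x , <-≤-trans x<s⁺E s⁺E≤s⁺E')

𝒟-initial : ∀ (σ : Word n) k → IsPerm σ → D (initial k (fixSet σ)) σ
𝒟-initial σ k perm = perm , λ x → mk⇔ (fixed-below x) (∈initial x)
  where
  P = initial k (fixSet σ)

  fixed-below : ∀ x → x ∈ P → app σ x ≡ x × toℕ x < sPlus P
  fixed-below x x∈P =
    Equivalence.to (∈fixSet⇔ σ x) (initial-⊆ k (fixSet σ) x∈P) , <sPlus x∈P

  ∈initial : ∀ x → app σ x ≡ x × toℕ x < sPlus P → x ∈ P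
  ∈initial x (σx≡x , x<s⁺P) with below-sPlus P x<s⁺P
  ... | y , y∈P , x≤y =
    initial-closed k (fixSet σ) (Equivalence.from (∈fixSet⇔ σ x) σx≡x) y∈P x≤y

InLg? : (g : Coll n) → Decidable (InLg g)
InLg? g A = anySubset? (λ B → (g B ≟ᵇ true) ×-dec Pointwise.decidable _≤ᶠ?_ (elems A) (elems B))

∈g⇒∈𝓛 : ∀ {g : Coll n} {E} → E ∈ᶜ g → InLg g E
∈g⇒∈𝓛 {E = E} E∈g = E , E∈g , Pointwise.refl ≤ᶠ-refl

minimal-antichain : ∀ {g : Coll n} → (∀ E → InL* g E ⇔ E ∈ᶜ g) →
                    ∀ {E E'} → E ∈ᶜ g → E' ∈ᶜ g → E ⊆ E' → E ≡ E'
minimal-antichain g≡min E∈g E'∈g E⊆E' =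
  proj₂ (Equivalence.from (g≡min _) E'∈g) _ (∈g⇒∈𝓛 E∈g) E⊆E'

-- If some member of g lies in F, then some initial segment of F is a minimal
-- member of 𝓛(g): take a smallest S ∈ 𝓛(g) inside F; initial ∣ S ∣ F lies
-- in 𝓛(S) ⊆ 𝓛(g), and any member of 𝓛(g) inside it is inside F, so has
-- size at least ∣ S ∣, and therefore is all of it.
minimal-initial : ∀ (g : Coll n) (F : Subset n) {B} → B ∈ᶜ g → B ⊆ F →
                  ∃[ k ] InL* g (initial k F)
minimal-initial g F B∈g B⊆F
  with least-size (λ S → InLg? g S ×-dec (S ⊆? F)) (∈g⇒∈𝓛 B∈g , B⊆F)
... | S , ((C , C∈g , S≤C) , S⊆F) , least = ∣ S ∣ , (C , C∈g , P≤C) , minimal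
  where
  P = initial ∣ S ∣ F

  P≤C : InL C P
  P≤C = Pointwise.transitive ≤ᶠ-trans (initial-∈𝓛 S⊆F) S≤C

  minimal : ∀ A → InLg g A → A ⊆ P → A ≡ P
  minimal A A∈𝓛 A⊆P = ⊆-size-≡ A⊆P
    (≤-trans (∣initial∣≤ ∣ S ∣ F) (least A (A∈𝓛 , λ x∈A → initial-⊆ ∣ S ∣ F (A⊆P x∈A))))

lemma2p14 : (n t : ℕ) → 1 ≤ t → (A : Family n) → (g : Coll n) →
    Maximal n t A → Fixed A → Compressed A → IsGenSet* A g →
    ((λ σ → σ ∈ᶠ A) ≐ (λ σ → ∃[ E ] (E ∈ᶜ g × D E σ))) ×
    (∀ E E' → E ∈ᶜ g → E' ∈ᶜ g → E ≢ E' → ∀ σ → ¬ (D E σ × D E' σ))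
lemma2p14 n t _ A g _ _ _ ((_ , 𝒰g≐A) , g≡min) = covering , disjoint
  where
  in-some-𝒟 : ∀ σ → σ ∈ᶠ A → ∃[ E ] (E ∈ᶜ g × D E σ)
  in-some-𝒟 σ σ∈A with Equivalence.from (𝒰g≐A σ) σ∈A
  ... | perm , B , B∈g , B-fixed
    with minimal-initial g (fixSet σ) B∈g (λ {x} x∈B → Equivalence.from (∈fixSet⇔ σ x) (B-fixed x x∈B))
  ... | k , P-minimal = initial k (fixSet σ) , Equivalence.to (g≡min _) P-minimal , 𝒟-initial σ k perm

  in-A : ∀ σ → ∃[ E ] (E ∈ᶜ g × D E σ) → σ ∈ᶠ A
  in-A σ (E , E∈g , perm , σ∈𝒟E) =
    Equivalence.to (𝒰g≐A σ) (perm , E , E∈g , λ x x∈E → proj₁ (Equivalence.to (σ∈𝒟E x) x∈E))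

  covering : (λ σ → σ ∈ᶠ A) ≐ (λ σ → ∃[ E ] (E ∈ᶜ g × D E σ))
  covering σ = mk⇔ (in-some-𝒟 σ) (in-A σ)

  disjoint : ∀ E E' → E ∈ᶜ g → E' ∈ᶜ g → E ≢ E' → ∀ σ → ¬ (D E σ × D E' σ)
  disjoint E E' E∈g E'∈g E≢E' σ (σ∈𝒟E , σ∈𝒟E') with ≤-total (sPlus E) (sPlus E')
  ... | inj₁ s⁺E≤s⁺E' = E≢E' (minimal-antichain g≡min E∈g E'∈g (𝒟-⊆ σ σ∈𝒟E σ∈𝒟E' s⁺E≤s⁺E'))
  ... | inj₂ s⁺E'≤s⁺E = E≢E' (sym (minimal-antichain g≡min E'∈g E∈g (𝒟-⊆ σ σ∈𝒟E' σ∈𝒟E s⁺E'≤s⁺E)))
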